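{- Let $\Lambda={\sf ITL}^0_{\Diamond\forall}$, let $\Sigma\subseteq\mathcal L_{\Diamond\forall}$ be finite and closed under subformulas, let $P$ be the set of prime $\mathcal L_{\Diamond\forall}$-types (with respect to $\Lambda$), ordered by $\Phi\preccurlyeq_c\Psi$ iff $\Phi^+\subseteq\Psi^+$ and $\Psi^-\subseteq\Phi^-$, and let $\Pi=(\Pi^+,\Pi^-)$ be a universal $\Sigma$-profile. Put $P[\Pi]=\{\Phi\in P:\Pi^+\subseteq\Phi^+\text{ and }\Pi^-\subseteq\Phi^-\}$. Then $P[\Pi]$ is upward closed under $\preccurlyeq_c$, and $P[\Pi]$ is honest with respect to $\Sigma$: for every $\Phi\in P[\Pi]$ and every $\forall\varphi\in\Sigma$, if $\forall\varphi\in\Phi^+$ then $\varphi\in\Psi^+$ for every $\Psi\in P[\Pi]$, and if $\forall\varphi\in\Phi^-$ then $\varphi\in\Psi^-$ for some $\Psi\in P[\Pi]$.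
   Context: $\mathcal L_{\Diamond\forall}$: formulas built from $\bot$, propositional variables, $\wedge,\vee,\to$ and ${\circ},\Diamond,\forall$; $\neg\varphi:=\varphi\to\bot$. ${\sf ITL}^0_{\Diamond\forall}$ is the least set of $\mathcal L_{\Diamond\forall}$-formulas containing all substitution instances of the intuitionistic propositional axioms and of $\neg{\circ}\bot$; ${\circ}\varphi\wedge{\circ}\psi\to{\circ}(\varphi\wedge\psi)$; ${\circ}(\varphi\vee\psi)\to{\circ}\varphi\vee{\circ}\psi$; ${\circ}(\varphi\to\psi)\to({\circ}\varphi\to{\circ}\psi)$; $\varphi\vee{\circ}\Diamond\varphi\to\Diamond\varphi$; $\forall\varphi\vee\neg\forall\varphi$; $\forall(\varphi\to\psi)\to(\forall\varphi\to\forall\psi)$; $\forall(\varphi\vee\forall\psi)\to\forall\varphi\vee\forall\psi$; $\forall\varphi\to\varphi$; $\forall\varphi\to\forall\forall\varphi$; $\forall\varphi\leftrightarrow{\circ}\forall\varphi$; closed under modus ponens, from $\varphi$ infer ${\circ}\varphi$, from $\varphi\to\psi$ infer $\Diamond\varphi\to\Diamond\psi$, from ${\circ}\varphi\to\varphi$ infer $\Diamond\varphi\to\varphi$, from $\varphi$ infer $\forall\varphi$. $\Gamma\vdash\Delta$ means there are finite $\Gamma'\subseteq\Gamma$, $\Delta'\subseteq\Delta$ with $\bigwedge\Gamma'\to\bigvee\Delta'\in\Lambda$. A prime type is a pair $(\Phi^+,\Phi^-)$ of sets of formulas with $\Phi^+\cup\Phi^-=\mathcal L_{\Diamond\forall}$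 and $\Phi^+\not\vdash\Phi^-$. $\Sigma_\forall$ is the set of formulas in $\Sigma$ of the form $\forall\varphi$; a universal $\Sigma$-profile is a partition $(\Pi^+,\Pi^-)$ of $\Sigma_\forall$ into two sets. -}

module Defs where

open import Data.Nat using (ℕ)
open import Data.List using (List; []; _∷_)
open import Data.List.Membership.Propositional using (_∈_)
open import Data.Product using (Σ; ∃; _×_; _,_)
open import Data.Sum using (_⊎_)
open import Relation.Nullary using (¬_)
open import Relation.Binary.PropositionalEquality using (_≡_)

infixr 5 _⇒_
infixr 6 _∨_
infixr 7 _∧_
data Fm : Set where
  ⊥'  : Fm
  var : ℕ → Fm
  _∧_ _∨_ _⇒_ : Fm → Fm → Fm
  ○ ◇ A : Fm → Fm          -- next, eventually, universal modality ∀

¬' : Fm → Fm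
¬' φ = φ ⇒ ⊥'

⊤' : Fm
⊤' = ⊥' ⇒ ⊥'

_⇔_ : Fm → Fm → Fm
φ ⇔ ψ = (φ ⇒ ψ) ∧ (ψ ⇒ φ)

data Λ : Fm → Set where
  ax-k   : ∀ φ ψ → Λ (φ ⇒ ψ ⇒ φ)
  ax-s   : ∀ φ ψ χ → Λ ((φ ⇒ ψ ⇒ χ) ⇒ (φ ⇒ ψ) ⇒ φ ⇒ χ)
  ax-∧e₁ : ∀ φ ψ → Λ (φ ∧ ψ ⇒ φ)
  ax-∧e₂ : ∀ φ ψ → Λ (φ ∧ ψ ⇒ ψ)
  ax-∧i  : ∀ φ ψ → Λ (φ ⇒ ψ ⇒ φ ∧ ψ)
  ax-∨i₁ : ∀ φ ψ → Λ (φ ⇒ φ ∨ ψ)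
  ax-∨i₂ : ∀ φ ψ → Λ (ψ ⇒ φ ∨ ψ)
  ax-∨e  : ∀ φ ψ χ → Λ ((φ ⇒ χ) ⇒ (ψ ⇒ χ) ⇒ φ ∨ ψ ⇒ χ)
  ax-efq : ∀ φ → Λ (⊥' ⇒ φ)
  ax-○⊥  : Λ (¬' (○ ⊥'))
  ax-○∧  : ∀ φ ψ → Λ (○ φ ∧ ○ ψ ⇒ ○ (φ ∧ ψ))
  ax-○∨  : ∀ φ ψ → Λ (○ (φ ∨ ψ) ⇒ ○ φ ∨ ○ ψ)
  ax-○⇒  : ∀ φ ψ → Λ (○ (φ ⇒ ψ) ⇒ ○ φ ⇒ ○ ψ)
  ax-◇   : ∀ φ → Λ (φ ∨ ○ (◇ φ) ⇒ ◇ φ)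
  ax-∀em : ∀ φ → Λ (A φ ∨ ¬' (A φ))
  ax-∀K  : ∀ φ ψ → Λ (A (φ ⇒ ψ) ⇒ A φ ⇒ A ψ)
  ax-∀∨  : ∀ φ ψ → Λ (A (φ ∨ A ψ) ⇒ A φ ∨ A ψ)
  ax-∀T  : ∀ φ → Λ (A φ ⇒ φ)
  ax-∀4  : ∀ φ → Λ (A φ ⇒ A (A φ))
  ax-∀○  : ∀ φ → Λ (A φ ⇔ ○ (A φ))
  mp     : ∀ {φ ψ} → Λ (φ ⇒ ψ) → Λ φ → Λ ψ
  nec○   : ∀ {φ} → Λ φ → Λ (○ φ)
  mono◇  : ∀ {φ ψ} → Λ (φ ⇒ ψ) → Λ (◇ φ ⇒ ◇ ψ)
  ind◇   : ∀ {φ} → Λ (○ φ ⇒ φ) → Λ (◇ φ ⇒ φ)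
  nec∀   : ∀ {φ} → Λ φ → Λ (A φ)

FmSet : Set₁
FmSet = Fm → Set

_⊆_ : FmSet → FmSet → Set
X ⊆ Y = ∀ {φ} → X φ → Y φ

⋀ : List Fm → Fm
⋀ []       = ⊤'
⋀ (φ ∷ Γ)  = φ ∧ ⋀ Γ

⋁ : List Fm → Fm
⋁ []       = ⊥'
⋁ (φ ∷ Δ)  = φ ∨ ⋁ Δ

_⊢_ : FmSet → FmSet → Set
Γ ⊢ Δ = Σ (List Fm) λ Γ' → Σ (List Fm) λ Δ' →
          (∀ {φ} → φ ∈ Γ' → Γ φ) × (∀ {φ} → φ ∈ Δ' → Δ φ) × Λ (⋀ Γ' ⇒ ⋁ Δ')

record Type : Set₁ where
  constructor ⟨_,_⟩
  field
    pos : FmSet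
    neg : FmSet
open Type public

IsPrime : Type → Set
IsPrime Φ = (∀ φ → pos Φ φ ⊎ neg Φ φ) × ¬ (pos Φ ⊢ neg Φ)

_≼c_ : Type → Type → Set
Φ ≼c Ψ = (pos Φ ⊆ pos Ψ) × (neg Ψ ⊆ neg Φ)

data ImmSub : Fm → Fm → Set where
  ∧l : ∀ {φ ψ} → ImmSub φ (φ ∧ ψ)
  ∧r : ∀ {φ ψ} → ImmSub ψ (φ ∧ ψ)
  ∨l : ∀ {φ ψ} → ImmSub φ (φ ∨ ψ)
  ∨r : ∀ {φ ψ} → ImmSub ψ (φ ∨ ψ)
  ⇒l : ∀ {φ ψ} → ImmSub φ (φ ⇒ ψ)
  ⇒r : ∀ {φ ψ} → ImmSub ψ (φ ⇒ ψ)
  ○s : ∀ {φ} → ImmSub φ (○ φ)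
  ◇s : ∀ {φ} → ImmSub φ (◇ φ)
  As : ∀ {φ} → ImmSub φ (A φ)

SubClosed : List Fm → Set
SubClosed Σ' = ∀ {φ ψ} → ImmSub φ ψ → ψ ∈ Σ' → φ ∈ Σ'

Univ : List Fm → FmSet
Univ Σ' φ = (∃ λ ψ → φ ≡ A ψ) × φ ∈ Σ'

IsProfile : List Fm → Type → Set
IsProfile Σ' Π = (pos Π ⊆ Univ Σ') × (neg Π ⊆ Univ Σ')
               × (∀ {φ} → Univ Σ' φ → pos Π φ ⊎ neg Π φ)
               × (∀ {φ} → pos Π φ → neg Π φ → ⊥)
  where open import Data.Empty using (⊥)

InP[_] : Type → Type → Set
InP[ Π ] Φ = IsPrime Φ × (pos Π ⊆ pos Φ) × (neg Π ⊆ neg Φ)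

-- Upward closure: a universal formula ∀ψ is decided by every prime type, since
-- ∀ψ ∨ ¬∀ψ is an axiom; so once ∀ψ is refuted in Φ, ¬∀ψ is accepted and stays
-- accepted in every Ψ ≽ Φ, which then refutes ∀ψ as well.
-- Honesty: if ∀φ is accepted in Φ ∈ P[Π] it lies in Π⁺ (it cannot lie in Π⁻ ⊆ Φ⁻),
-- so every Ψ ∈ P[Π] accepts ∀φ and hence φ by ∀φ → φ. If ∀φ is refuted in Φ, the
-- type with positive part the universal formulas accepted by Φ and negative part φ
-- together with the universal formulas refuted by Φ is consistent: a derivation
-- ⋀Γ → φ ∨ ⋁Δ from it can be boxed (a conjunction of universal formulas implies its
-- own ∀ by axiom 4), and then the axiom ∀(χ ∨ ∀ψ) → ∀χ ∨ ∀ψ pulls the universal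
-- disjuncts out, giving ⋀Γ → ∀φ ∨ ⋁Δ inside Φ. A Lindenbaum extension of it
-- (using excluded middle) is the required Ψ ∈ P[Π] refuting φ.
module Submission where

open import Defs
open import Level using (0ℓ)
open import Axiom.ExcludedMiddle using (ExcludedMiddle)
open import Data.List using (List; []; _∷_; _++_; map; concatMap; cartesianProductWith)
open import Data.List.Membership.Propositional using (_∈_; lose)
open import Data.List.Membership.Propositional.Properties
  using (∈-++⁺ˡ; ∈-++⁺ʳ; ∈-++⁻; ∈-map⁺; ∈-map⁻; ∈-concatMap⁺; ∈-cartesianProductWith⁺)
open import Data.List.Relation.Unary.Any using (here; there)
open import Data.Product using (Σ; ∃; _×_; _,_; proj₁; proj₂)
open import Data.Sum using (_⊎_; inj₁; inj₂)
open import Data.Empty using (⊥; ⊥-elim)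
open import Data.Nat using (ℕ; zero; suc; _⊔_; _≤′_; ≤′-refl; ≤′-step)
open import Data.Nat.Properties using (m≤m⊔n; m≤n⊔m; ≤⇒≤′)
open import Relation.Nullary using (¬_; yes; no)
open import Relation.Binary.PropositionalEquality using (_≡_; refl)

infixr 4 _⨾_

⇒-refl : ∀ {a} → Λ (a ⇒ a)
⇒-refl {a} = mp (mp (ax-s a (a ⇒ a) a) (ax-k a (a ⇒ a))) (ax-k a a)

⇒-const : ∀ {g c} → Λ c → Λ (g ⇒ c)
⇒-const {g} {c} = mp (ax-k c g)

⇒-app : ∀ {g a b} → Λ (g ⇒ a ⇒ b) → Λ (g ⇒ a) → Λ (g ⇒ b)
⇒-app {g} {a} {b} f = mp (mp (ax-s g a b) f)

_⨾_ : ∀ {a b c} → Λ (a ⇒ b) → Λ (b ⇒ c) → Λ (a ⇒ c)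
f ⨾ h = ⇒-app (⇒-const h) f

∧-fst : ∀ {a b} → Λ (a ∧ b ⇒ a)
∧-fst = ax-∧e₁ _ _

∧-snd : ∀ {a b} → Λ (a ∧ b ⇒ b)
∧-snd = ax-∧e₂ _ _

∧-intro : ∀ {g a b} → Λ (g ⇒ a) → Λ (g ⇒ b) → Λ (g ⇒ a ∧ b)
∧-intro {g} {a} {b} p q = ⇒-app (⇒-app (⇒-const (ax-∧i a b)) p) q

∧-curry : ∀ {g a c} → Λ (g ∧ a ⇒ c) → Λ (g ⇒ a ⇒ c)
∧-curry {g} {a} {c} f = ⇒-app (⇒-const (mp (ax-s a (g ∧ a) c) (⇒-const f))) (ax-∧i g a)

∨-inl : ∀ {a b} → Λ (a ⇒ a ∨ b)
∨-inl = ax-∨i₁ _ _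

∨-inr : ∀ {a b} → Λ (b ⇒ a ∨ b)
∨-inr = ax-∨i₂ _ _

∨-elim : ∀ {a b c} → Λ (a ⇒ c) → Λ (b ⇒ c) → Λ (a ∨ b ⇒ c)
∨-elim {a} {b} {c} f h = mp (mp (ax-∨e a b c) f) h

∨-cases : ∀ {g a b c} → Λ (g ⇒ a ∨ b) → Λ (g ∧ a ⇒ c) → Λ (g ∧ b ⇒ c) → Λ (g ⇒ c)
∨-cases {g} {a} {b} {c} d f h =
  ⇒-app (⇒-app (⇒-app (⇒-const (ax-∨e a b c)) (∧-curry f)) (∧-curry h)) d

⋀-++ : ∀ xs ys → Λ (⋀ (xs ++ ys) ⇒ ⋀ xs ∧ ⋀ ys)
⋀-++ []       ys = ∧-intro (⇒-const ⇒-refl) ⇒-refl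
⋀-++ (x ∷ xs) ys = ∧-intro (∧-intro ∧-fst (rest ⨾ ∧-fst)) (rest ⨾ ∧-snd)
  where rest = ∧-snd ⨾ ⋀-++ xs ys

⋁-++ : ∀ xs ys → Λ (⋁ xs ∨ ⋁ ys ⇒ ⋁ (xs ++ ys))
⋁-++ []       ys = ∨-elim (ax-efq _) ⇒-refl
⋁-++ (x ∷ xs) ys =
  ∨-elim (∨-elim ∨-inl (∨-inl ⨾ ⋁-++ xs ys ⨾ ∨-inr)) (∨-inr ⨾ ⋁-++ xs ys ⨾ ∨-inr)

infixl 6 _∪₁_

_∪₁_ : FmSet → Fm → FmSet
(X ∪₁ x) y = X y ⊎ y ≡ x

⊢-mono : ∀ {X X′ Y Y′} → X ⊆ X′ → Y ⊆ Y′ → X ⊢ Y → X′ ⊢ Y′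
⊢-mono f h (Γ , Δ , γ , δ , d) = Γ , Δ , (λ m → f (γ m)) , (λ m → h (δ m)) , d

⊢-single : ∀ {X Y : FmSet} {a b} → X a → Y b → Λ (a ⇒ b) → X ⊢ Y
⊢-single {a = a} {b} x y f =
  a ∷ [] , b ∷ [] , (λ { (here refl) → x }) , (λ { (here refl) → y }) , ∧-fst ⨾ f ⨾ ∨-inl

⋀-split : ∀ {X x} Γ → (∀ {y} → y ∈ Γ → (X ∪₁ x) y) →
  Σ (List Fm) λ Γ′ → (∀ {y} → y ∈ Γ′ → X y) × Λ (⋀ Γ′ ∧ x ⇒ ⋀ Γ)
⋀-split []      γ = [] , (λ ()) , ∧-fst
⋀-split (y ∷ Γ) γ with ⋀-split Γ (λ m → γ (there m)) | γ (here refl)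
... | Γ′ , γ′ , d | inj₁ Xy =
  y ∷ Γ′ , (λ { (here refl) → Xy ; (there m) → γ′ m }) ,
  ∧-intro (∧-fst ⨾ ∧-fst) (∧-intro (∧-fst ⨾ ∧-snd) ∧-snd ⨾ d)
... | Γ′ , γ′ , d | inj₂ refl = Γ′ , γ′ , ∧-intro ∧-snd d

⋁-split : ∀ {Y x} Δ → (∀ {y} → y ∈ Δ → (Y ∪₁ x) y) →
  Σ (List Fm) λ Δ′ → (∀ {y} → y ∈ Δ′ → Y y) × Λ (⋁ Δ ⇒ x ∨ ⋁ Δ′)
⋁-split []      δ = [] , (λ ()) , ax-efq _
⋁-split (y ∷ Δ) δ with ⋁-split Δ (λ m → δ (there m)) | δ (here refl)
... | Δ′ , δ′ , d | inj₁ Yy =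
  y ∷ Δ′ , (λ { (here refl) → Yy ; (there m) → δ′ m }) ,
  ∨-elim (∨-inl ⨾ ∨-inr) (d ⨾ ∨-elim ∨-inl (∨-inr ⨾ ∨-inr))
... | Δ′ , δ′ , d | inj₂ refl = Δ′ , δ′ , ∨-elim ∨-inl d

⊢-cut : ∀ {X Y x} → (X ∪₁ x) ⊢ Y → X ⊢ (Y ∪₁ x) → X ⊢ Y
⊢-cut {X} {Y} {x} (Γ₁ , Δ₁ , γ₁ , δ₁ , d₁) (Γ₂ , Δ₂ , γ₂ , δ₂ , d₂)
  with ⋀-split Γ₁ γ₁ | ⋁-split Δ₂ δ₂
... | Γ₁′ , γ₁′ , e₁ | Δ₂′ , δ₂′ , e₂ =
  Γ₁′ ++ Γ₂ , Δ₁ ++ Δ₂′ , γ , δ ,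
  ∨-cases (split ⨾ ∧-snd ⨾ d₂ ⨾ e₂) left (∧-snd ⨾ ∨-inr ⨾ ⋁-++ Δ₁ Δ₂′)
  where
    split = ⋀-++ Γ₁′ Γ₂
    left = ∧-intro (∧-fst ⨾ split ⨾ ∧-fst) ∧-snd ⨾ e₁ ⨾ d₁ ⨾ ∨-inl ⨾ ⋁-++ Δ₁ Δ₂′
    γ : ∀ {y} → y ∈ Γ₁′ ++ Γ₂ → X y
    γ m with ∈-++⁻ Γ₁′ m
    ... | inj₁ m₁ = γ₁′ m₁
    ... | inj₂ m₂ = γ₂ m₂
    δ : ∀ {y} → y ∈ Δ₁ ++ Δ₂′ → Y y
    δ m with ∈-++⁻ Δ₁ m
    ... | inj₁ m₁ = δ₁ m₁
    ... | inj₂ m₂ = δ₂′ m₂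

prime-disjoint : ∀ {Φ a} → IsPrime Φ → pos Φ a → neg Φ a → ⊥
prime-disjoint (_ , cons) p n = cons (⊢-single p n ⇒-refl)

prime-pos-closed : ∀ {Φ a b} → IsPrime Φ → Λ (a ⇒ b) → pos Φ a → pos Φ b
prime-pos-closed {b = b} (total , cons) f p with total b
... | inj₁ pb = pb
... | inj₂ nb = ⊥-elim (cons (⊢-single p nb f))

prime-neg-closed : ∀ {Φ a b} → IsPrime Φ → Λ (a ⇒ b) → neg Φ b → neg Φ a
prime-neg-closed {a = a} (total , cons) f n with total a
... | inj₁ pa = ⊥-elim (cons (⊢-single pa n f))
... | inj₂ na = na

prime-pos-of-∨ : ∀ {Φ a b} → IsPrime Φ → Λ (a ∨ b) → neg Φ a → pos Φ b
prime-pos-of-∨ {a = a} {b} (total , cons) d na with total b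
... | inj₁ pb = pb
... | inj₂ nb = ⊥-elim (cons ([] , a ∷ b ∷ [] , (λ ()) ,
  (λ { (here refl) → na ; (there (here refl)) → nb }) ,
  ⇒-const (mp (∨-elim ∨-inl (∨-inl ⨾ ∨-inr)) d)))

prime-neg-of-¬ : ∀ {Φ a} → IsPrime Φ → pos Φ (¬' a) → neg Φ a
prime-neg-of-¬ {a = a} (total , cons) p¬ with total a
... | inj₂ na = na
... | inj₁ pa = ⊥-elim (cons (a ∷ ¬' a ∷ [] , [] ,
  (λ { (here refl) → pa ; (there (here refl)) → p¬ }) , (λ ()) ,
  ⇒-app (∧-snd ⨾ ∧-fst) ∧-fst))

decided-neg-≼c : ∀ {Φ Ψ a} → Λ (a ∨ ¬' a) → IsPrime Φ → IsPrime Ψ → Φ ≼c Ψ →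
  neg Φ a → neg Ψ a
decided-neg-≼c em-a prΦ prΨ (⊆⁺ , _) na =
  prime-neg-of-¬ prΨ (⊆⁺ (prime-pos-of-∨ prΦ em-a na))

Consistent : Type → Set
Consistent T = ¬ (pos T ⊢ neg T)

infix 4 _⊑_

_⊑_ : Type → Type → Set
T ⊑ U = (pos T ⊆ pos U) × (neg T ⊆ neg U)

⊑-refl : ∀ {T} → T ⊑ T
⊑-refl = (λ p → p) , (λ n → n)

⊑-trans : ∀ {T U V} → T ⊑ U → U ⊑ V → T ⊑ V
⊑-trans (p₁ , n₁) (p₂ , n₂) = (λ p → p₂ (p₁ p)) , (λ n → n₂ (n₁ n))

decide : Fm → Type → Type
decide x T = ⟨ (λ y → pos T y ⊎ (y ≡ x × ¬ RefutesX)) , (λ y → neg T y ⊎ (y ≡ x × RefutesX)) ⟩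
  where RefutesX = (pos T ∪₁ x) ⊢ neg T

decide-⊒ : ∀ x T → T ⊑ decide x T
decide-⊒ x T = inj₁ , inj₁

decide-total : ExcludedMiddle 0ℓ → ∀ x T → pos (decide x T) x ⊎ neg (decide x T) x
decide-total em x T with em {(pos T ∪₁ x) ⊢ neg T}
... | yes r = inj₂ (inj₂ (refl , r))
... | no ¬r = inj₁ (inj₂ (refl , ¬r))

decide-consistent : ExcludedMiddle 0ℓ → ∀ x T → Consistent T → Consistent (decide x T)
decide-consistent em x T cons d with em {(pos T ∪₁ x) ⊢ neg T}
... | yes r = cons (⊢-cut r (⊢-mono to-pos to-neg∪x d))
  where
    to-pos : pos (decide x T) ⊆ pos T
    to-pos (inj₁ p)       = p
    to-pos (inj₂ (_ , ¬r)) = ⊥-elim (¬r r)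
    to-neg∪x : neg (decide x T) ⊆ (neg T ∪₁ x)
    to-neg∪x (inj₁ n)       = inj₁ n
    to-neg∪x (inj₂ (e , _)) = inj₂ e
... | no ¬r = ¬r (⊢-mono to-pos∪x to-neg d)
  where
    to-pos∪x : pos (decide x T) ⊆ (pos T ∪₁ x)
    to-pos∪x (inj₁ p)       = inj₁ p
    to-pos∪x (inj₂ (e , _)) = inj₂ e
    to-neg : neg (decide x T) ⊆ neg T
    to-neg (inj₁ n)      = n
    to-neg (inj₂ (_ , r)) = ⊥-elim (¬r r)

decideAll : List Fm → Type → Type
decideAll []       T = T
decideAll (x ∷ xs) T = decideAll xs (decide x T)

decideAll-⊒ : ∀ xs T → T ⊑ decideAll xs T
decideAll-⊒ []       T = ⊑-refl
decideAll-⊒ (x ∷ xs) T = ⊑-trans (decide-⊒ x T) (decideAll-⊒ xs (decide x T))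

decideAll-total : ExcludedMiddle 0ℓ → ∀ {y} xs T → y ∈ xs →
  pos (decideAll xs T) y ⊎ neg (decideAll xs T) y
decideAll-total em (x ∷ xs) T (here refl) with decide-total em x T | decideAll-⊒ xs (decide x T)
... | inj₁ p | ⊆⁺ , _ = inj₁ (⊆⁺ p)
... | inj₂ n | _ , ⊆⁻ = inj₂ (⊆⁻ n)
decideAll-total em (x ∷ xs) T (there m) = decideAll-total em xs (decide x T) m

decideAll-consistent : ExcludedMiddle 0ℓ → ∀ xs T → Consistent T → Consistent (decideAll xs T)
decideAll-consistent em []       T cons = cons
decideAll-consistent em (x ∷ xs) T cons =
  decideAll-consistent em xs (decide x T) (decide-consistent em x T cons)

unaryConnectives : List (Fm → Fm)
unaryConnectives = ○ ∷ ◇ ∷ A ∷ []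

binaryConnectives : List (Fm → Fm → Fm)
binaryConnectives = _∧_ ∷ _∨_ ∷ _⇒_ ∷ []

unaryApplications : List Fm → List Fm
unaryApplications Fs = concatMap (λ f → map f Fs) unaryConnectives

binaryApplications : List Fm → List Fm
binaryApplications Fs = concatMap (λ f → cartesianProductWith f Fs Fs) binaryConnectives

formulasUpTo : ℕ → List Fm
formulasUpTo zero    = ⊥' ∷ []
formulasUpTo (suc n) = formulasUpTo n ++ var n ∷ unaryApplications (formulasUpTo n)
                                               ++ binaryApplications (formulasUpTo n)

formulasUpTo-mono : ∀ {m n y} → m ≤′ n → y ∈ formulasUpTo m → y ∈ formulasUpTo n
formulasUpTo-mono ≤′-refl        y∈ = y∈
formulasUpTo-mono (≤′-step m≤′n) y∈ = ∈-++⁺ˡ (formulasUpTo-mono m≤′n y∈)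

∈-unaryApplications : ∀ {f a} Fs → f ∈ unaryConnectives → a ∈ Fs → f a ∈ unaryApplications Fs
∈-unaryApplications {f} Fs f∈ a∈ = ∈-concatMap⁺ (λ f → map f Fs) (lose f∈ (∈-map⁺ f a∈))

∈-binaryApplications : ∀ {f a b} Fs → f ∈ binaryConnectives → a ∈ Fs → b ∈ Fs →
  f a b ∈ binaryApplications Fs
∈-binaryApplications {f} Fs f∈ a∈ b∈ =
  ∈-concatMap⁺ (λ f → cartesianProductWith f Fs Fs) (lose f∈ (∈-cartesianProductWith⁺ f a∈ b∈))

∃-formulasUpTo-unary : ∀ {f a} → f ∈ unaryConnectives →
  (∃ λ n → a ∈ formulasUpTo n) → ∃ λ n → f a ∈ formulasUpTo n
∃-formulasUpTo-unary f∈ (n , a∈) =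
  suc n , ∈-++⁺ʳ (formulasUpTo n) (there (∈-++⁺ˡ (∈-unaryApplications (formulasUpTo n) f∈ a∈)))

∃-formulasUpTo-binary : ∀ {f a b} → f ∈ binaryConnectives →
  (∃ λ m → a ∈ formulasUpTo m) → (∃ λ n → b ∈ formulasUpTo n) →
  ∃ λ n → f a b ∈ formulasUpTo n
∃-formulasUpTo-binary f∈ (m , a∈) (n , b∈) =
  suc (m ⊔ n) , ∈-++⁺ʳ (formulasUpTo (m ⊔ n)) (there (∈-++⁺ʳ (unaryApplications Fs)
    (∈-binaryApplications Fs f∈ (formulasUpTo-mono (≤⇒≤′ (m≤m⊔n m n)) a∈)
                                (formulasUpTo-mono (≤⇒≤′ (m≤n⊔m m n)) b∈))))
  where Fs = formulasUpTo (m ⊔ n)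

formulasUpTo-covers : ∀ φ → ∃ λ n → φ ∈ formulasUpTo n
formulasUpTo-covers ⊥'      = zero , here refl
formulasUpTo-covers (var k) = suc k , ∈-++⁺ʳ (formulasUpTo k) (here refl)
formulasUpTo-covers (a ∧ b) =
  ∃-formulasUpTo-binary (here refl) (formulasUpTo-covers a) (formulasUpTo-covers b)
formulasUpTo-covers (a ∨ b) =
  ∃-formulasUpTo-binary (there (here refl)) (formulasUpTo-covers a) (formulasUpTo-covers b)
formulasUpTo-covers (a ⇒ b) =
  ∃-formulasUpTo-binary (there (there (here refl))) (formulasUpTo-covers a) (formulasUpTo-covers b)
formulasUpTo-covers (○ a) = ∃-formulasUpTo-unary (here refl) (formulasUpTo-covers a)
formulasUpTo-covers (◇ a) = ∃-formulasUpTo-unary (there (here refl)) (formulasUpTo-covers a)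
formulasUpTo-covers (A a) = ∃-formulasUpTo-unary (there (there (here refl))) (formulasUpTo-covers a)

chain-bound : (P : ℕ → Fm → Set) → (∀ {m n y} → m ≤′ n → P m y → P n y) →
  ∀ xs → (∀ {y} → y ∈ xs → ∃ λ n → P n y) → ∃ λ N → ∀ {y} → y ∈ xs → P N y
chain-bound P mono []       bound = zero , λ ()
chain-bound P mono (x ∷ xs) bound with chain-bound P mono xs (λ m → bound (there m)) | bound (here refl)
... | N , P-N | n , P-n = n ⊔ N , λ where
  (here refl) → mono (≤⇒≤′ (m≤m⊔n n N)) P-n
  (there m)   → mono (≤⇒≤′ (m≤n⊔m n N)) (P-N m)

stage : Type → ℕ → Type
stage T zero    = T
stage T (suc n) = decideAll (formulasUpTo n) (stage T n)

stage-mono : ∀ T {m n} → m ≤′ n → stage T m ⊑ stage T n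
stage-mono T ≤′-refl                = ⊑-refl
stage-mono T {n = suc n} (≤′-step m≤′n) =
  ⊑-trans (stage-mono T m≤′n) (decideAll-⊒ (formulasUpTo n) (stage T n))

stage-consistent : ExcludedMiddle 0ℓ → ∀ T → Consistent T → ∀ n → Consistent (stage T n)
stage-consistent em T cons zero    = cons
stage-consistent em T cons (suc n) =
  decideAll-consistent em (formulasUpTo n) (stage T n) (stage-consistent em T cons n)

⋃stage : Type → Type
⋃stage T = ⟨ (λ y → ∃ λ n → pos (stage T n) y) , (λ y → ∃ λ n → neg (stage T n) y) ⟩

⋃stage-total : ExcludedMiddle 0ℓ → ∀ T y → pos (⋃stage T) y ⊎ neg (⋃stage T) y
⋃stage-total em T y with formulasUpTo-covers y
... | n , y∈ with decideAll-total em (formulasUpTo n) (stage T n) y∈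
... | inj₁ p = inj₁ (suc n , p)
... | inj₂ q = inj₂ (suc n , q)

⋃stage-consistent : ExcludedMiddle 0ℓ → ∀ T → Consistent T → Consistent (⋃stage T)
⋃stage-consistent em T cons (Γ , Δ , γ , δ , d)
  with chain-bound (λ n y → pos (stage T n) y) (λ m≤′n → proj₁ (stage-mono T m≤′n)) Γ γ
     | chain-bound (λ n y → neg (stage T n) y) (λ m≤′n → proj₂ (stage-mono T m≤′n)) Δ δ
... | N₁ , γ′ | N₂ , δ′ =
  stage-consistent em T cons (N₁ ⊔ N₂)
    (Γ , Δ , (λ m → proj₁ (stage-mono T (≤⇒≤′ (m≤m⊔n N₁ N₂))) (γ′ m))
           , (λ m → proj₂ (stage-mono T (≤⇒≤′ (m≤n⊔m N₁ N₂))) (δ′ m)) , d)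

lindenbaum : ExcludedMiddle 0ℓ → ∀ T → Consistent T → ∃ λ Ψ → IsPrime Ψ × T ⊑ Ψ
lindenbaum em T cons =
  ⋃stage T , (⋃stage-total em T , ⋃stage-consistent em T cons) , (λ p → zero , p) , (λ n → zero , n)

IsA : FmSet
IsA δ = ∃ λ ψ → δ ≡ A ψ

A-mono : ∀ {a b} → Λ (a ⇒ b) → Λ (A a ⇒ A b)
A-mono {a} {b} f = mp (ax-∀K a b) (nec∀ f)

A-∧ : ∀ {a b} → Λ (A a ∧ A b ⇒ A (a ∧ b))
A-∧ {a} {b} = ⇒-app (∧-fst ⨾ A-mono (ax-∧i a b) ⨾ ax-∀K b (a ∧ b)) ∧-snd

⋀-IsA⇒A : ∀ Γ → (∀ {δ} → δ ∈ Γ → IsA δ) → Λ (⋀ Γ ⇒ A (⋀ Γ))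
⋀-IsA⇒A []      _ = ⇒-const (nec∀ ⇒-refl)
⋀-IsA⇒A (δ ∷ Γ) univ with univ (here refl)
... | ψ , refl = ∧-intro (∧-fst ⨾ ax-∀4 ψ) (∧-snd ⨾ ⋀-IsA⇒A Γ (λ m → univ (there m))) ⨾ A-∧

-- Universal disjuncts are pulled out of A by ax-∀∨; the copies of φ are collected in χ ∨ φ.
A-⋁-extract : ∀ φ Δ → (∀ {δ} → δ ∈ Δ → (IsA ∪₁ φ) δ) →
  ∀ χ → Λ (A (χ ∨ ⋁ Δ) ⇒ A (χ ∨ φ) ∨ ⋁ (map A Δ))
A-⋁-extract φ []      _    χ = A-mono (∨-elim ∨-inl (ax-efq _)) ⨾ ∨-inl
A-⋁-extract φ (δ ∷ Δ) form χ with form (here refl)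
... | inj₂ refl =
  A-mono (∨-elim (∨-inl ⨾ ∨-inl) (∨-elim (∨-inr ⨾ ∨-inl) ∨-inr))
  ⨾ A-⋁-extract φ Δ (λ m → form (there m)) (χ ∨ φ)
  ⨾ ∨-elim (A-mono (∨-elim ⇒-refl ∨-inr) ⨾ ∨-inl) (∨-inr ⨾ ∨-inr)
... | inj₁ (ψ , refl) =
  A-mono (∨-elim (∨-inl ⨾ ∨-inl) (∨-elim ∨-inr (∨-inr ⨾ ∨-inl)))
  ⨾ ax-∀∨ (χ ∨ ⋁ Δ) ψ
  ⨾ ∨-elim (A-⋁-extract φ Δ (λ m → form (there m)) χ ⨾ ∨-elim ∨-inl (∨-inr ⨾ ∨-inr))
           (ax-∀4 ψ ⨾ ∨-inl ⨾ ∨-inr)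

universalSeed : Type → Fm → Type
universalSeed Φ φ = ⟨ (λ δ → IsA δ × pos Φ δ) , (λ δ → IsA δ × neg Φ δ) ∪₁ φ ⟩

universalSeed-consistent : ∀ {Φ φ} → IsPrime Φ → neg Φ (A φ) → Consistent (universalSeed Φ φ)
universalSeed-consistent {Φ} {φ} prΦ nAφ (Γ , Δ , γ , δ , d) =
  proj₂ prΦ (Γ , A φ ∷ map A Δ , (λ m → proj₂ (γ m)) , refuted ,
    ⋀-IsA⇒A Γ (λ m → proj₁ (γ m)) ⨾ A-mono (d ⨾ ∨-inr)
    ⨾ A-⋁-extract φ Δ shape ⊥' ⨾ ∨-elim (A-mono (∨-elim (ax-efq φ) ⇒-refl) ⨾ ∨-inl) ∨-inr)
  where
    shape : ∀ {y} → y ∈ Δ → (IsA ∪₁ φ) y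
    shape m with δ m
    ... | inj₁ (univ , _) = inj₁ univ
    ... | inj₂ y≡φ        = inj₂ y≡φ
    refuted : ∀ {y} → y ∈ A φ ∷ map A Δ → neg Φ y
    refuted (here refl) = nAφ
    refuted (there m) with ∈-map⁻ A m
    ... | y , y∈ , refl with δ y∈
    ... | inj₂ refl               = nAφ
    ... | inj₁ ((ψ , refl) , nAψ) = prime-neg-closed prΦ (ax-∀T (A ψ)) nAψ

P[Π]-upward : ∀ {Σ' Π Φ Ψ} → IsProfile Σ' Π →
  InP[ Π ] Φ → IsPrime Ψ → Φ ≼c Ψ → InP[ Π ] Ψ
P[Π]-upward {Π = Π} {Ψ = Ψ} (_ , neg-univ , _ , _) (prΦ , Π⁺⊆ , Π⁻⊆) prΨ Φ≼Ψ@(⊆⁺ , _) =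
  prΨ , (λ p → ⊆⁺ (Π⁺⊆ p)) , Π⁻⊆Ψ⁻
  where
    Π⁻⊆Ψ⁻ : neg Π ⊆ neg Ψ
    Π⁻⊆Ψ⁻ n with neg-univ n
    ... | (ψ , refl) , _ = decided-neg-≼c (ax-∀em ψ) prΦ prΨ Φ≼Ψ (Π⁻⊆ n)

P[Π]-honest-pos : ∀ {Σ' Π Φ φ} → IsProfile Σ' Π → A φ ∈ Σ' →
  InP[ Π ] Φ → pos Φ (A φ) → ∀ Ψ → InP[ Π ] Ψ → pos Ψ φ
P[Π]-honest-pos {φ = φ} (_ , _ , split , _) Aφ∈Σ (prΦ , _ , Π⁻⊆) pAφ Ψ (prΨ , Π⁺⊆ , _)
  with split ((φ , refl) , Aφ∈Σ)
... | inj₁ Aφ∈Π⁺ = prime-pos-closed prΨ (ax-∀T φ) (Π⁺⊆ Aφ∈Π⁺)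
... | inj₂ Aφ∈Π⁻ = ⊥-elim (prime-disjoint prΦ pAφ (Π⁻⊆ Aφ∈Π⁻))

P[Π]-honest-neg : ExcludedMiddle 0ℓ → ∀ {Σ' Π Φ φ} → IsProfile Σ' Π →
  InP[ Π ] Φ → neg Φ (A φ) → ∃ λ Ψ → InP[ Π ] Ψ × neg Ψ φ
P[Π]-honest-neg em {Φ = Φ} {φ} (pos-univ , neg-univ , _ , _) (prΦ , Π⁺⊆ , Π⁻⊆) nAφ
  with lindenbaum em (universalSeed Φ φ) (universalSeed-consistent prΦ nAφ)
... | Ψ , prΨ , ⊆⁺ , ⊆⁻ =
  Ψ , (prΨ , (λ p → ⊆⁺ (proj₁ (pos-univ p) , Π⁺⊆ p))
           , (λ n → ⊆⁻ (inj₁ (proj₁ (neg-univ n) , Π⁻⊆ n))))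
    , ⊆⁻ (inj₂ refl)

lemma9p3 : ExcludedMiddle 0ℓ →
    (Σ' : List Fm) → SubClosed Σ' → (Π : Type) → IsProfile Σ' Π →
    -- upward closed
    (∀ Φ Ψ → InP[ Π ] Φ → IsPrime Ψ → Φ ≼c Ψ → InP[ Π ] Ψ)
    ×
    -- honest w.r.t. Σ
    (∀ Φ → InP[ Π ] Φ → ∀ φ → A φ ∈ Σ' →
       ((pos Φ (A φ) → ∀ Ψ → InP[ Π ] Ψ → pos Ψ φ)
        × (neg Φ (A φ) → Σ Type λ Ψ → InP[ Π ] Ψ × neg Ψ φ)))
lemma9p3 em _ _ _ profile =
  (λ _ _ → P[Π]-upward profile) ,
  (λ _ Φ∈P _ Aφ∈Σ → P[Π]-honest-pos profile Aφ∈Σ Φ∈P , P[Π]-honest-neg em profile Φ∈P)
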